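{- For $n\ge1$ let $C_n=\frac1n\binom{2n-2}{n-1}$ and $g_n=2^nC_n$. Let $y_n$ be the number of rows with value $0$ in the truth tables of all bracketed m-implications with $n$ distinct variables, and let $f_n$ be the number of rows with value $0$ in the truth tables of all bracketed implications with $n$ distinct variables (both defined in the context). Then \[ \frac{y_n}{g_n}\ \ge\ \frac{f_n}{g_n}. \]
   Context: Truth values are $1$ (true), $0$ (false). The connective $\rightharpoonup$ satisfies $\nu(\phi\rightharpoonup\psi)=0$ iff $\nu(\phi)=\nu(\psi)=1$, and $=1$ otherwise; the ordinary implication satisfies $\nu(\phi\to\psi)=0$ iff $\nu(\phi)=1,\nu(\psi)=0$. For a binary connective $\ast$, a bracketed formula with $n$ variables is a well-formed formula obtained from $p_1\ast p_2\ast\cdots\ast p_n$ ($p_i$ distinct variables, in this order) by inserting brackets. $y_n$ (resp. $f_n$) is the total, over all bracketed formulae $\phi$ with connective $\rightharpoonup$ (resp. $\to$), of the number of valuations $\nu$ of $p_1,\dots,p_n$ with $\nu(\phi)=0$. Equivalently, $f_1=1$, $f_n=\sum_{i=1}^{n-1}(2^iC_i-f_i)f_{n-i}$, and $y_1=1$, $y_n=\sum_{i=1}^{n-1}(2^iC_i-y_i)(2^{n-i}C_{n-i}-y_{n-i})$ for $n\ge2$. The inequality is asserted for all $n\ge1$. -}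

module Defs where

open import Data.Bool using (Bool; true; false; not; _∧_; _∨_; if_then_else_)
open import Data.Nat using (ℕ; zero; suc; _+_; _*_; _∸_; _^_; _≤_; _<_; z≤n; s≤s; NonZero; >-nonZero)
open import Data.Nat.Properties using (≤-trans; m≤m+n; +-mono-≤; m*n≢0; m^n>0; ≤-refl)
open import Data.Nat.DivMod using (_/_; m≥n⇒m/n>0)
open import Data.Nat.Combinatorics using (_C_; nCk+nC[k+1]≡[n+1]C[k+1])
open import Data.List using (List; []; _∷_; [_]; map; concatMap; upTo)
open import Data.Nat.ListAction using (sum)
open import Data.Product using (_×_; _,_; proj₁)
open import Relation.Binary.PropositionalEquality using (_≡_; subst; cong; trans; sym)

-- Catalan-type numbers:  C n = (1/n) * binom(2n-2, n-1),  g n = 2^n Cat n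
-- (only meaningful for n ≥ 1; the division is exact there).

Cat : ℕ → ℕ
Cat zero    = 0
Cat (suc m) = ((2 * m) C m) / suc m

g : ℕ → ℕ
g n = 2 ^ n * Cat n

-- Bracketed formulae p₁ ∗ p₂ ∗ ⋯ ∗ pₙ : binary trees whose leaves are
-- the variables p₁,…,pₙ in left-to-right order.

data Tree : Set where
  leaf : Tree
  node : Tree → Tree → Tree

-- all bracketings with exactly n leaves (the fuel argument is ≥ n, so
-- it never runs out; it only makes the recursion structural)
bracketings′ : ℕ → ℕ → List Tree
bracketings′ _        zero          = []
bracketings′ _        (suc zero)    = [ leaf ]
bracketings′ zero     (suc (suc _)) = []
bracketings′ (suc fu) n@(suc (suc _)) =
  concatMap (λ i → concatMap (λ l → map (node l) (bracketings′ fu (n ∸ suc i)))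
                             (bracketings′ fu (suc i)))
            (upTo (n ∸ 1))

bracketings : ℕ → List Tree
bracketings n = bracketings′ n n

-- evaluation of a bracketed formula with connective ⊛, the leaves
-- consuming the valuation ν(p₁),…,ν(pₙ) from left to right
eval′ : (Bool → Bool → Bool) → Tree → List Bool → Bool × List Bool
eval′ _ leaf []       = false , []   -- never used for well-sized valuations
eval′ _ leaf (b ∷ bs) = b , bs
eval′ ⊛ (node l r) bs with eval′ ⊛ l bs
... | a , bs′ with eval′ ⊛ r bs′
... | c , bs″ = ⊛ a c , bs″

eval : (Bool → Bool → Bool) → Tree → List Bool → Bool
eval ⊛ t ν = proj₁ (eval′ ⊛ t ν)

valuations : ℕ → List (List Bool)
valuations zero    = [ [] ]
valuations (suc n) = concatMap (λ ν → (false ∷ ν) ∷ (true ∷ ν) ∷ []) (valuations n)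

_⇀_ : Bool → Bool → Bool       -- m-implication: 0 iff both are 1
a ⇀ b = not (a ∧ b)

_⇒_ : Bool → Bool → Bool
a ⇒ b = not a ∨ b

zeroRows : (Bool → Bool → Bool) → ℕ → ℕ
zeroRows ⊛ n =
  sum (map (λ t → sum (map (λ ν → if eval ⊛ t ν then 0 else 1) (valuations n)))
           (bracketings n))

y : ℕ → ℕ
y = zeroRows _⇀_

f : ℕ → ℕ
f = zeroRows _⇒_

private
  C-pos : ∀ n k → k ≤ n → 1 ≤ n C k
  C-pos n zero _ = s≤s z≤n
  C-pos (suc n) (suc k) (s≤s k≤n) =
    subst (1 ≤_) (nCk+nC[k+1]≡[n+1]C[k+1] n k)
          (≤-trans (C-pos n k k≤n) (m≤m+n _ _))

  C-big : ∀ n k → 1 ≤ k → k < n → n ≤ n C k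
  C-big (suc n) (suc zero) _ (s≤s _) =
    subst (suc n ≤_) (nCk+nC[k+1]≡[n+1]C[k+1] n 0) ≤-refl'
    where ≤-refl' : suc n ≤ n C 0 + n C 1
          ≤-refl' = subst (λ x → suc n ≤ 1 + x) (sym (Data.Nat.Combinatorics.nC1≡n n)) ≤-refl
            where import Data.Nat.Combinatorics
  C-big (suc n) (suc (suc k)) _ (s≤s k<n) =
    subst (suc n ≤_) (nCk+nC[k+1]≡[n+1]C[k+1] n (suc k))
      (subst (λ x → x ≤ n C suc k + n C suc (suc k)) (Data.Nat.Properties.+-comm n 1)
        (+-mono-≤ (C-big n (suc k) (s≤s z≤n) k<n) (C-pos n (suc (suc k)) k<n)))
    where import Data.Nat.Properties

  2m≥m+1 : ∀ m → suc m ≤ (2 * m) C m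
  2m≥m+1 zero = s≤s z≤n
  2m≥m+1 (suc m) = ≤-trans lem (C-big (2 * suc m) (suc m) (s≤s z≤n) lt)
    where
      open import Data.Nat.Properties using (+-suc; +-identityʳ)
      eq : 2 * suc m ≡ suc (suc (m + m))
      eq = cong suc (trans (cong (m +_) (+-identityʳ (suc m))) (+-suc m m))
      lem : suc (suc m) ≤ 2 * suc m
      lem = subst (suc (suc m) ≤_) (sym eq) (s≤s (s≤s (m≤m+n m m)))
      lt : suc m < 2 * suc m
      lt = subst (suc m <_) (sym eq) (s≤s (s≤s (m≤m+n m m)))

C-pos′ : ∀ m → 1 ≤ Cat (suc m)
C-pos′ m = m≥n⇒m/n>0 (2m≥m+1 m)

g-nonZero : ∀ {n} → 1 ≤ n → NonZero (g n)
g-nonZero {suc m} _ = m*n≢0 (2 ^ suc m) (Cat (suc m))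
  {{>-nonZero (m^n>0 2 (suc m))}} {{>-nonZero (C-pos′ m)}}

-- Let G n be the total number of rows (2^n for each bracketing) and write x for δ, so that x ⋆ a
-- shifts a by one.  Splitting a bracketing at its root gives G = 2x + G⋆G, f = x + (G − f)⋆f and
-- y = x + (G − y)⋆(G − y).  Strong induction proves f n ≤ y n and 2 y n ≤ G n together.  The first
-- holds because below n we have f ≤ y ≤ G − y termwise, so (G − f)⋆f ≤ (G − y)⋆(G − y).  For the
-- second, G ≤ 4y below n bounds 4(G − y) by 3G − 2x, whence 16 y n ≤ 9 G n − 12 G (n−1); this
-- suffices since G n ≤ 8 G (n−1), a consequence of the exact recurrence (n+1) G (n+1) = (8n − 4) G n
-- obtained by differentiating G = 2x + G⋆G.

module Submission where

open import Defs
open import Data.Nat using (ℕ; _≤_)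
open import Data.Integer using (+_)
open import Data.Rational using (_/_)
open import Data.Rational as ℚ using ()

open import Function using (_∘_)
open import Data.Bool using (Bool; true; false; if_then_else_)
open import Data.Nat hiding (_/_)
open import Data.Nat.Properties
open import Data.Nat.Induction using (<-rec)
open import Data.Nat.Tactic.RingSolver using (solve-∀)
open import Data.Nat.ListAction using (sum)
open import Data.Nat.ListAction.Properties using (sum-++)
import Data.Integer as ℤ
import Data.Integer.Properties as ℤ
import Data.Rational.Properties as ℚ
import Data.Rational.Unnormalised as ℚᵘ
import Data.Rational.Unnormalised.Properties as ℚᵘ
open import Data.List using (List; []; _∷_; _++_; map; concat; concatMap; applyUpTo; upTo; length)
open import Data.List.Properties
  using (map-++; map-∘; map-cong; map-cong-local; ++-assoc; ++-identityʳ; length-++)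
open import Data.List.Relation.Unary.All as All using (All; []; _∷_)
import Data.List.Relation.Unary.All.Properties as All
open import Data.Product using (_×_; _,_; proj₁; proj₂; ∃₂)
open import Relation.Binary.PropositionalEquality
open import Algebra.Properties.CommutativeSemigroup +-commutativeSemigroup
  using () renaming (interchange to +-interchange)

-- Sequences, finite sums and the Cauchy product

Seq : Set
Seq = ℕ → ℕ

infixl 7 _⋆_
infixr 8 _·_
infixl 6 _⊕_

_⊕_ : Seq → Seq → Seq
(a ⊕ b) n = a n + b n

_·_ : ℕ → Seq → Seq
(c · a) n = c * a n

∑< : ℕ → Seq → ℕ
∑< zero    h = 0
∑< (suc m) h = h 0 + ∑< m (h ∘ suc)

∑<-cong : ∀ m {h h′ : Seq} → (∀ {i} → i < m → h i ≡ h′ i) → ∑< m h ≡ ∑< m h′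
∑<-cong zero    eq = refl
∑<-cong (suc m) eq = cong₂ _+_ (eq z<s) (∑<-cong m (eq ∘ s<s))

∑<-mono-≤ : ∀ m {h h′ : Seq} → (∀ {i} → i < m → h i ≤ h′ i) → ∑< m h ≤ ∑< m h′
∑<-mono-≤ zero    le = z≤n
∑<-mono-≤ (suc m) le = +-mono-≤ (le z<s) (∑<-mono-≤ m (le ∘ s<s))

∑<-distrib-+ : ∀ m (h h′ : Seq) → ∑< m (h ⊕ h′) ≡ ∑< m h + ∑< m h′
∑<-distrib-+ zero    h h′ = refl
∑<-distrib-+ (suc m) h h′ rewrite ∑<-distrib-+ m (h ∘ suc) (h′ ∘ suc) =
  +-interchange (h 0) (h′ 0) (∑< m (h ∘ suc)) (∑< m (h′ ∘ suc))

∑<-distribˡ-* : ∀ m c (h : Seq) → ∑< m (c · h) ≡ c * ∑< m h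
∑<-distribˡ-* zero    c h = sym (*-zeroʳ c)
∑<-distribˡ-* (suc m) c h rewrite ∑<-distribˡ-* m c (h ∘ suc) =
  sym (*-distribˡ-+ c (h 0) _)

∑<-zero : ∀ m → ∑< m (λ _ → 0) ≡ 0
∑<-zero zero    = refl
∑<-zero (suc m) = ∑<-zero m

∑<-suc : ∀ m (h : Seq) → ∑< (suc m) h ≡ ∑< m h + h m
∑<-suc zero    h = +-identityʳ (h 0)
∑<-suc (suc m) h rewrite ∑<-suc m (h ∘ suc) = sym (+-assoc (h 0) _ _)

∑<-reverse : ∀ m (h : Seq) → ∑< m h ≡ ∑< m (λ i → h (m ∸ suc i))
∑<-reverse zero    h = refl
∑<-reverse (suc m) h = begin
  ∑< (suc m) h                          ≡⟨ ∑<-suc m h ⟩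
  ∑< m h + h m                          ≡⟨ cong (_+ h m) (∑<-reverse m h) ⟩
  ∑< m (λ i → h (m ∸ suc i)) + h m      ≡⟨ +-comm _ (h m) ⟩
  ∑< (suc m) (λ i → h (suc m ∸ suc i))  ∎
  where open ≡-Reasoning

⋆-term : Seq → Seq → ℕ → Seq
⋆-term a b n i = a i * b (n ∸ i)

_⋆_ : Seq → Seq → Seq
(a ⋆ b) n = ∑< (suc n) (⋆-term a b n)

⋆-cong : ∀ a a′ b b′ → (∀ i → a i ≡ a′ i) → (∀ i → b i ≡ b′ i) → ∀ n → (a ⋆ b) n ≡ (a′ ⋆ b′) n
⋆-cong a a′ b b′ ea eb n = ∑<-cong (suc n) λ {i} _ → cong₂ _*_ (ea i) (eb (n ∸ i))

⋆-comm : ∀ a b n → (a ⋆ b) n ≡ (b ⋆ a) n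
⋆-comm a b n = trans (∑<-reverse (suc n) (⋆-term a b n)) (∑<-cong (suc n) λ {i} i<1+n →
  trans (cong (a (n ∸ i) *_) (cong b (m∸[m∸n]≡n (≤-pred i<1+n)))) (*-comm (a (n ∸ i)) (b i)))

⋆-distribʳ-⊕ : ∀ a a′ b n → ((a ⊕ a′) ⋆ b) n ≡ (a ⋆ b) n + (a′ ⋆ b) n
⋆-distribʳ-⊕ a a′ b n = trans (∑<-cong (suc n) λ {i} _ → *-distribʳ-+ (b (n ∸ i)) (a i) (a′ i))
  (∑<-distrib-+ (suc n) (⋆-term a b n) (⋆-term a′ b n))

⋆-distribˡ-⊕ : ∀ a b b′ n → (a ⋆ (b ⊕ b′)) n ≡ (a ⋆ b) n + (a ⋆ b′) n
⋆-distribˡ-⊕ a b b′ n = trans (∑<-cong (suc n) λ {i} _ → *-distribˡ-+ (a i) (b (n ∸ i)) (b′ (n ∸ i)))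
  (∑<-distrib-+ (suc n) (⋆-term a b n) (⋆-term a b′ n))

·-⋆ : ∀ c a b n → (c · a ⋆ b) n ≡ c * (a ⋆ b) n
·-⋆ c a b n = trans (∑<-cong (suc n) λ {i} _ → *-assoc c (a i) (b (n ∸ i)))
  (∑<-distribˡ-* (suc n) c (⋆-term a b n))

⋆-· : ∀ c a b n → (a ⋆ c · b) n ≡ c * (a ⋆ b) n
⋆-· c a b n = trans (⋆-comm a (c · b) n) (trans (·-⋆ c b a n) (cong (c *_) (⋆-comm b a n)))

⋆-assoc : ∀ a b c n → (a ⋆ b ⋆ c) n ≡ (a ⋆ (b ⋆ c)) n
⋆-assoc a b c zero = assoc (a 0) (b 0) (c 0)
  where
  assoc : ∀ x y z → (x * y + 0) * z + 0 ≡ x * (y * z + 0) + 0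
  assoc = solve-∀
⋆-assoc a b c (suc n) = begin
  (a 0 * b 0 + 0) * c (suc n) + ((a ⋆ b) ∘ suc ⋆ c) n
    ≡⟨ cong (_+_ head) (⋆-distribʳ-⊕ (a 0 · b ∘ suc) (a ∘ suc ⋆ b) c n) ⟩
  (a 0 * b 0 + 0) * c (suc n) + ((a 0 · b ∘ suc ⋆ c) n + (a ∘ suc ⋆ b ⋆ c) n)
    ≡⟨ cong₂ (λ u v → head + (u + v)) (·-⋆ (a 0) (b ∘ suc) c n) (⋆-assoc (a ∘ suc) b c n) ⟩
  (a 0 * b 0 + 0) * c (suc n) + (a 0 * (b ∘ suc ⋆ c) n + (a ∘ suc ⋆ (b ⋆ c)) n)
    ≡⟨ regroup (a 0) (b 0) (c (suc n)) _ _ ⟩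
  a 0 * (b ⋆ c) (suc n) + (a ∘ suc ⋆ (b ⋆ c)) n ∎
  where
  open ≡-Reasoning
  head = (a 0 * b 0 + 0) * c (suc n)
  regroup : ∀ x y z u v → (x * y + 0) * z + (x * u + v) ≡ x * (y * z + u) + v
  regroup = solve-∀

δ : Seq
δ 1 = 1
δ _ = 0

δ-⋆ : ∀ a n → (δ ⋆ a) (suc n) ≡ a n
δ-⋆ a n = trans (cong (_+_ (a n + 0)) (∑<-zero n)) (trans (+-identityʳ _) (+-identityʳ _))

⋆-δ : ∀ a n → (a ⋆ δ) (suc n) ≡ a n
⋆-δ a n = trans (⋆-comm a δ (suc n)) (δ-⋆ a n)

⋆-interior : ∀ a b n → a 0 ≡ 0 → b 0 ≡ 0 →
             (a ⋆ b) (2 + n) ≡ ∑< (suc n) (λ i → a (suc i) * b (suc n ∸ i))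
⋆-interior a b n a0 b0
  rewrite a0 | ∑<-suc (suc n) (λ i → a (suc i) * b (suc n ∸ i)) | n∸n≡0 n | b0 | *-zeroʳ (a (2 + n)) =
  +-identityʳ _

xD : Seq → Seq
xD a n = n * a n

xD-⋆ : ∀ a b n → xD (a ⋆ b) n ≡ (xD a ⋆ b) n + (a ⋆ xD b) n
xD-⋆ a b n = begin
  n * (a ⋆ b) n
    ≡⟨ ∑<-distribˡ-* (suc n) n (⋆-term a b n) ⟨
  ∑< (suc n) (n · ⋆-term a b n)
    ≡⟨ ∑<-cong (suc n) (λ {i} i≤n → split i (≤-pred i≤n)) ⟩
  ∑< (suc n) (⋆-term (xD a) b n ⊕ ⋆-term a (xD b) n)
    ≡⟨ ∑<-distrib-+ (suc n) (⋆-term (xD a) b n) (⋆-term a (xD b) n) ⟩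
  (xD a ⋆ b) n + (a ⋆ xD b) n
    ∎
  where
  open ≡-Reasoning
  distrib : ∀ i j x y → (i + j) * (x * y) ≡ i * x * y + x * (j * y)
  distrib = solve-∀
  split : ∀ i → i ≤ n → n * ⋆-term a b n i ≡ ⋆-term (xD a) b n i + ⋆-term a (xD b) n i
  split i i≤n = trans (cong (_* ⋆-term a b n i) (sym (m+[n∸m]≡n i≤n))) (distrib i (n ∸ i) (a i) (b (n ∸ i)))

⋆-mono-≤ : ∀ a a′ b b′ n → a 0 ≡ 0 → b 0 ≡ 0 →
           (∀ {i} → 0 < i → i < n → a i ≤ a′ i) → (∀ {i} → 0 < i → i < n → b i ≤ b′ i) →
           (a ⋆ b) n ≤ (a′ ⋆ b′) n
⋆-mono-≤ a a′ b b′ n a0 b0 a≤a′ b≤b′ = ∑<-mono-≤ (suc n) (λ {i} i≤n → term i (≤-pred i≤n))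
  where
  term : ∀ i → i ≤ n → ⋆-term a b n i ≤ ⋆-term a′ b′ n i
  term zero _ rewrite a0 = z≤n
  term (suc i) i<n with n ∸ suc i in eq
  ... | zero  rewrite b0 | *-zeroʳ (a (suc i)) = z≤n
  ... | suc j = *-mono-≤ (a≤a′ z<s (m∸n≢0⇒n<m (λ e → 0≢1+n (trans (sym e) eq))))
                          (b≤b′ z<s (subst (_< n) eq (∸-monoʳ-< z<s i<n)))

⋆-1 : ∀ a b → a 0 ≡ 0 → b 0 ≡ 0 → (a ⋆ b) 1 ≡ 0
⋆-1 a b a0 b0 rewrite a0 | b0 | *-zeroʳ (a 1) = refl

⋆-2 : ∀ a b → a 0 ≡ 0 → b 0 ≡ 0 → (a ⋆ b) 2 ≡ a 1 * b 1
⋆-2 a b a0 b0 rewrite a0 | b0 | *-zeroʳ (a 2) = +-identityʳ _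

double : ∀ x → x + x ≡ 2 * x
double = solve-∀

xD-δ : ∀ n → xD δ n ≡ δ n
xD-δ 0             = refl
xD-δ 1             = refl
xD-δ (suc (suc n)) = *-zeroʳ (suc (suc n))

-- The recurrence G = c δ + G ⋆ G

module CatalanRecurrence (c : ℕ) (G : Seq) (G-rec : ∀ n → G n ≡ (c · δ ⊕ G ⋆ G) n) where

  private
    D P : Seq
    D = xD G
    P = G ⋆ (G ⋆ D)

    D-rec : ∀ n → D n ≡ c * δ n + 2 * (G ⋆ D) n
    D-rec n = begin
      n * G n                            ≡⟨ cong (n *_) (G-rec n) ⟩
      n * (c * δ n + (G ⋆ G) n)          ≡⟨ distrib n c (δ n) _ ⟩
      c * xD δ n + xD (G ⋆ G) n          ≡⟨ cong₂ (λ u v → c * u + v) (xD-δ n) (xD-⋆ G G n) ⟩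
      c * δ n + ((D ⋆ G) n + (G ⋆ D) n)  ≡⟨ cong (λ u → c * δ n + (u + (G ⋆ D) n)) (⋆-comm D G n) ⟩
      c * δ n + ((G ⋆ D) n + (G ⋆ D) n)  ≡⟨ cong (_+_ (c * δ n)) (double ((G ⋆ D) n)) ⟩
      c * δ n + 2 * (G ⋆ D) n            ∎
      where
      open ≡-Reasoning
      distrib : ∀ n c d s → n * (c * d + s) ≡ c * (n * d) + n * s
      distrib = solve-∀

    ⋆D-rec₁ : ∀ n → (G ⋆ D) (suc n) ≡ c * G n + 2 * P (suc n)
    ⋆D-rec₁ n = begin
      (G ⋆ D) (suc n)
        ≡⟨ ⋆-cong G G D (c · δ ⊕ 2 · (G ⋆ D)) (λ _ → refl) D-rec (suc n) ⟩
      (G ⋆ (c · δ ⊕ 2 · (G ⋆ D))) (suc n)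
        ≡⟨ ⋆-distribˡ-⊕ G (c · δ) (2 · (G ⋆ D)) (suc n) ⟩
      (G ⋆ c · δ) (suc n) + (G ⋆ 2 · (G ⋆ D)) (suc n)
        ≡⟨ cong₂ _+_ (⋆-· c G δ (suc n)) (⋆-· 2 G (G ⋆ D) (suc n)) ⟩
      c * (G ⋆ δ) (suc n) + 2 * P (suc n)
        ≡⟨ cong (λ u → c * u + 2 * P (suc n)) (⋆-δ G n) ⟩
      c * G n + 2 * P (suc n)
        ∎
      where open ≡-Reasoning

    ⋆D-rec₂ : ∀ n → (G ⋆ D) (suc n) ≡ c * D n + P (suc n)
    ⋆D-rec₂ n = begin
      (G ⋆ D) (suc n)
        ≡⟨ ⋆-cong G (c · δ ⊕ G ⋆ G) D D G-rec (λ _ → refl) (suc n) ⟩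
      ((c · δ ⊕ G ⋆ G) ⋆ D) (suc n)
        ≡⟨ ⋆-distribʳ-⊕ (c · δ) (G ⋆ G) D (suc n) ⟩
      (c · δ ⋆ D) (suc n) + (G ⋆ G ⋆ D) (suc n)
        ≡⟨ cong₂ _+_ (·-⋆ c δ D (suc n)) (⋆-assoc G G D (suc n)) ⟩
      c * (δ ⋆ D) (suc n) + P (suc n)
        ≡⟨ cong (λ u → c * u + P (suc n)) (δ-⋆ D n) ⟩
      c * D n + P (suc n)
        ∎
      where open ≡-Reasoning

  xD-rec : ∀ n → xD G (suc (suc n)) + 2 * c * G (suc n) ≡ 4 * c * xD G (suc n)
  xD-rec n = begin
    D (2 + n) + 2 * c * G (1 + n)
      ≡⟨ cong (_+ 2 * c * G (1 + n)) (D-rec (2 + n)) ⟩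
    c * 0 + 2 * (G ⋆ D) (2 + n) + 2 * c * G (1 + n)
      ≡⟨ cong (λ u → c * 0 + 2 * u + 2 * c * G (1 + n)) (⋆D-rec₁ (1 + n)) ⟩
    c * 0 + 2 * (c * G (1 + n) + 2 * p) + 2 * c * G (1 + n)
      ≡⟨ collect c (G (1 + n)) p ⟩
    4 * (c * G (1 + n) + p)
      ≡⟨ cong (4 *_) cD≡cG+P ⟨
    4 * (c * D (1 + n))
      ≡⟨ *-assoc 4 c (D (1 + n)) ⟨
    4 * c * D (1 + n)
      ∎
    where
    open ≡-Reasoning
    p = P (2 + n)
    collect : ∀ c g p → c * 0 + 2 * (c * g + 2 * p) + 2 * c * g ≡ 4 * (c * g + p)
    collect = solve-∀
    cD≡cG+P : c * D (1 + n) ≡ c * G (1 + n) + p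
    cD≡cG+P = +-cancelʳ-≡ p _ _ (begin
      c * D (1 + n) + p         ≡⟨ ⋆D-rec₂ (1 + n) ⟨
      (G ⋆ D) (2 + n)           ≡⟨ ⋆D-rec₁ (1 + n) ⟩
      c * G (1 + n) + 2 * p     ≡⟨ cong (_+_ (c * G (1 + n))) (double p) ⟨
      c * G (1 + n) + (p + p)   ≡⟨ +-assoc (c * G (1 + n)) p p ⟨
      c * G (1 + n) + p + p     ∎)

  ratio-bound : ∀ n → G (suc (suc n)) ≤ 4 * c * G (suc n)
  ratio-bound n = *-cancelˡ-≤ (2 + n) (begin
    (2 + n) * G (2 + n)                          ≤⟨ m≤m+n _ _ ⟩
    xD G (2 + n) + 2 * c * G (1 + n)             ≡⟨ xD-rec n ⟩
    4 * c * ((1 + n) * G (1 + n))                ≤⟨ *-monoʳ-≤ (4 * c) (*-monoˡ-≤ _ (n≤1+n (1 + n))) ⟩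
    4 * c * ((2 + n) * G (1 + n))                ≡⟨ swap (4 * c) (2 + n) (G (1 + n)) ⟩
    (2 + n) * (4 * c * G (1 + n))                ∎)
    where
    open ≤-Reasoning
    swap : ∀ a b x → a * (b * x) ≡ b * (a * x)
    swap = solve-∀

-- Comparing the zero rows of the two connectives

16y+12g′≤9g⇒2y≤g : ∀ y g g′ → 16 * y + 12 * g′ ≤ 9 * g → g ≤ 8 * g′ → 2 * y ≤ g
16y+12g′≤9g⇒2y≤g y g g′ 16y+12g′≤9g g≤8g′ =
  *-cancelˡ-≤ 16 (≤-trans 32y≤15g (*-monoˡ-≤ g (n≤1+n 15)))
  where
  open ≤-Reasoning
  32y≤15g : 16 * (2 * y) ≤ 15 * g
  32y≤15g = +-cancelʳ-≤ (3 * g) (16 * (2 * y)) (15 * g) (begin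
    16 * (2 * y) + 3 * g          ≤⟨ +-monoʳ-≤ (16 * (2 * y)) (*-monoʳ-≤ 3 g≤8g′) ⟩
    16 * (2 * y) + 3 * (8 * g′)   ≡⟨ regroup y g′ ⟩
    2 * (16 * y + 12 * g′)        ≤⟨ *-monoʳ-≤ 2 16y+12g′≤9g ⟩
    2 * (9 * g)                   ≡⟨ split g ⟩
    15 * g + 3 * g                ∎)
    where
    regroup : ∀ y g′ → 16 * (2 * y) + 3 * (8 * g′) ≡ 2 * (16 * y + 12 * g′)
    regroup = solve-∀
    split : ∀ g → 2 * (9 * g) ≡ 15 * g + 3 * g
    split = solve-∀

module ZeroRowComparison
  (G A Y T F : Seq)
  (G₀    : G 0 ≡ 0)
  (G-rec : ∀ n → G n ≡ (2 · δ ⊕ G ⋆ G) n)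
  (Y-rec : ∀ n → Y n ≡ (δ ⊕ A ⋆ A) n)
  (F-rec : ∀ n → F n ≡ (δ ⊕ T ⋆ F) n)
  (A+Y≡G : ∀ n → A n + Y n ≡ G n)
  (T+F≡G : ∀ n → T n + F n ≡ G n)
  where

  private
    A₀ : A 0 ≡ 0
    A₀ = m+n≡0⇒m≡0 (A 0) (trans (A+Y≡G 0) G₀)

    Y₀ : Y 0 ≡ 0
    Y₀ = m+n≡0⇒n≡0 (A 0) (trans (A+Y≡G 0) G₀)

    T₀ : T 0 ≡ 0
    T₀ = m+n≡0⇒m≡0 (T 0) (trans (T+F≡G 0) G₀)

    F₀ : F 0 ≡ 0
    F₀ = m+n≡0⇒n≡0 (T 0) (trans (T+F≡G 0) G₀)

    G₁ : G 1 ≡ 2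
    G₁ = trans (G-rec 1) (cong (_+_ 2) (⋆-1 G G G₀ G₀))

    Y₁ : Y 1 ≡ 1
    Y₁ = trans (Y-rec 1) (cong (_+_ 1) (⋆-1 A A A₀ A₀))

    A₁ : A 1 ≡ 1
    A₁ = +-cancelʳ-≡ 1 (A 1) 1 (begin
      A 1 + 1    ≡⟨ cong (_+_ (A 1)) Y₁ ⟨
      A 1 + Y 1  ≡⟨ A+Y≡G 1 ⟩
      G 1        ≡⟨ G₁ ⟩
      2          ∎)
      where open ≡-Reasoning

  Bounds : ℕ → Set
  Bounds n = F n ≤ Y n × 2 * Y n ≤ G n

  private
    Y≤A : ∀ {n} → 2 * Y n ≤ G n → Y n ≤ A n
    Y≤A {n} 2Y≤G = +-cancelʳ-≤ (Y n) (Y n) (A n) (begin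
      Y n + Y n  ≡⟨ double (Y n) ⟩
      2 * Y n    ≤⟨ 2Y≤G ⟩
      G n        ≡⟨ A+Y≡G n ⟨
      A n + Y n  ∎)
      where open ≤-Reasoning

    G≤2A : ∀ {n} → 2 * Y n ≤ G n → G n ≤ 2 * A n
    G≤2A {n} 2Y≤G = begin
      G n        ≡⟨ A+Y≡G n ⟨
      A n + Y n  ≤⟨ +-monoʳ-≤ (A n) (Y≤A 2Y≤G) ⟩
      A n + A n  ≡⟨ double (A n) ⟩
      2 * A n    ∎
      where open ≤-Reasoning

    F≤Y-step : ∀ n → (∀ {i} → i < n → Bounds i) → F n ≤ Y n
    F≤Y-step n below = begin
      F n
        ≡⟨ F-rec n ⟩
      δ n + (T ⋆ F) n
        ≤⟨ +-monoʳ-≤ (δ n) (⋆-mono-≤ T (A ⊕ d) F F n T₀ F₀ (λ _ i<n → ≤-reflexive (T≡A+d i<n)) (λ _ _ → ≤-refl)) ⟩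
      δ n + ((A ⊕ d) ⋆ F) n
        ≡⟨ cong (_+_ (δ n)) (⋆-distribʳ-⊕ A d F n) ⟩
      δ n + ((A ⋆ F) n + (d ⋆ F) n)
        ≡⟨ cong (λ u → δ n + ((A ⋆ F) n + u)) (⋆-comm d F n) ⟩
      δ n + ((A ⋆ F) n + (F ⋆ d) n)
        ≤⟨ +-monoʳ-≤ (δ n) (+-monoʳ-≤ ((A ⋆ F) n) (⋆-mono-≤ F A d d n F₀ d₀ (λ _ → F≤A) (λ _ _ → ≤-refl))) ⟩
      δ n + ((A ⋆ F) n + (A ⋆ d) n)
        ≡⟨ cong (_+_ (δ n)) (⋆-distribˡ-⊕ A F d n) ⟨
      δ n + (A ⋆ (F ⊕ d)) n
        ≤⟨ +-monoʳ-≤ (δ n) (⋆-mono-≤ A A (F ⊕ d) A n A₀ F+d₀ (λ _ _ → ≤-refl) (λ _ → F+d≤A)) ⟩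
      δ n + (A ⋆ A) n
        ≡⟨ Y-rec n ⟨
      Y n
        ∎
      where
      open ≤-Reasoning
      d : Seq
      d i = Y i ∸ F i
      d₀ : d 0 ≡ 0
      d₀ = cong₂ _∸_ Y₀ F₀
      F+d₀ : (F ⊕ d) 0 ≡ 0
      F+d₀ = cong₂ _+_ F₀ d₀
      F+d≡Y : ∀ {i} → i < n → F i + d i ≡ Y i
      F+d≡Y i<n = m+[n∸m]≡n (proj₁ (below i<n))
      T≡A+d : ∀ {i} → i < n → T i ≡ A i + d i
      T≡A+d {i} i<n = +-cancelʳ-≡ (F i) (T i) (A i + d i) (begin-equality
        T i + F i        ≡⟨ T+F≡G i ⟩
        G i              ≡⟨ A+Y≡G i ⟨
        A i + Y i        ≡⟨ cong (_+_ (A i)) (F+d≡Y i<n) ⟨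
        A i + (F i + d i) ≡⟨ cong (_+_ (A i)) (+-comm (F i) (d i)) ⟩
        A i + (d i + F i) ≡⟨ +-assoc (A i) (d i) (F i) ⟨
        A i + d i + F i  ∎)
      F≤A : ∀ {i} → i < n → F i ≤ A i
      F≤A i<n = ≤-trans (proj₁ (below i<n)) (Y≤A (proj₂ (below i<n)))
      F+d≤A : ∀ {i} → i < n → F i + d i ≤ A i
      F+d≤A i<n = ≤-trans (≤-reflexive (F+d≡Y i<n)) (Y≤A (proj₂ (below i<n)))

    G≤4Y : ∀ n → (∀ {i} → i < 2 + n → Bounds i) → G (2 + n) ≤ 4 * Y (2 + n)
    G≤4Y n below = begin
      G m                      ≡⟨ G-rec m ⟩
      (G ⋆ G) m                ≤⟨ ⋆-mono-≤ G (2 · A) G (2 · A) m G₀ G₀ G≤2A′ G≤2A′ ⟩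
      (2 · A ⋆ 2 · A) m        ≡⟨ ·-⋆ 2 A (2 · A) m ⟩
      2 * (A ⋆ 2 · A) m        ≡⟨ cong (2 *_) (⋆-· 2 A A m) ⟩
      2 * (2 * (A ⋆ A) m)      ≡⟨ *-assoc 2 2 ((A ⋆ A) m) ⟨
      4 * (A ⋆ A) m            ≡⟨ cong (4 *_) (Y-rec m) ⟨
      4 * Y m                  ∎
      where
      open ≤-Reasoning
      m = 2 + n
      G≤2A′ : ∀ {i} → 0 < i → i < m → G i ≤ 2 * A i
      G≤2A′ _ i<m = G≤2A (proj₂ (below i<m))

    -- H = 3G − 2δ, written without truncated subtraction
    H : Seq
    H 0 = 0
    H 1 = 4
    H n = 3 * G n

    H+2δ≡3G : ∀ n → H n + 2 * δ n ≡ 3 * G n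
    H+2δ≡3G 0             = cong (3 *_) (sym G₀)
    H+2δ≡3G 1             = cong (3 *_) (sym G₁)
    H+2δ≡3G (suc (suc n)) = +-identityʳ _

    4A≤H : ∀ n → (∀ {i} → i < n → Bounds i) → ∀ {i} → 0 < i → i < n → 4 * A i ≤ H i
    4A≤H n below {1} _ _ = ≤-reflexive (cong (4 *_) A₁)
    4A≤H n below {suc (suc j)} _ i<n = +-cancelʳ-≤ (G i) (4 * A i) (3 * G i) (begin
      4 * A i + G i        ≤⟨ +-monoʳ-≤ (4 * A i) (G≤4Y j (λ k<i → below (<-trans k<i i<n))) ⟩
      4 * A i + 4 * Y i    ≡⟨ *-distribˡ-+ 4 (A i) (Y i) ⟨
      4 * (A i + Y i)      ≡⟨ cong (4 *_) (A+Y≡G i) ⟩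
      4 * G i              ≡⟨ *-distribʳ-+ (G i) 3 1 ⟩
      3 * G i + 1 * G i    ≡⟨ cong (_+_ (3 * G i)) (*-identityˡ (G i)) ⟩
      3 * G i + G i        ∎)
      where
      open ≤-Reasoning
      i = suc (suc j)

    16Y≤H⋆H : ∀ n → (∀ {i} → i < 2 + n → Bounds i) → 16 * Y (2 + n) ≤ (H ⋆ H) (2 + n)
    16Y≤H⋆H n below = begin
      16 * Y m
        ≡⟨ cong (16 *_) (Y-rec m) ⟩
      16 * (A ⋆ A) m
        ≡⟨ *-assoc 4 4 ((A ⋆ A) m) ⟩
      4 * (4 * (A ⋆ A) m)
        ≡⟨ cong (4 *_) (⋆-· 4 A A m) ⟨
      4 * (A ⋆ 4 · A) m
        ≡⟨ ·-⋆ 4 A (4 · A) m ⟨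
      (4 · A ⋆ 4 · A) m
        ≤⟨ ⋆-mono-≤ (4 · A) H (4 · A) H m (cong (4 *_) A₀) (cong (4 *_) A₀) (4A≤H m below) (4A≤H m below) ⟩
      (H ⋆ H) m
        ∎
      where
      open ≤-Reasoning
      m = 2 + n

    9G≡H⋆H+12G : ∀ n → 9 * G (3 + n) ≡ (H ⋆ H) (3 + n) + 12 * G (2 + n)
    9G≡H⋆H+12G n = begin
      9 * G m
        ≡⟨ cong (9 *_) (G-rec m) ⟩
      9 * (G ⋆ G) m
        ≡⟨ *-assoc 3 3 ((G ⋆ G) m) ⟩
      3 * (3 * (G ⋆ G) m)
        ≡⟨ cong (3 *_) (⋆-· 3 G G m) ⟨
      3 * (G ⋆ 3 · G) m
        ≡⟨ ·-⋆ 3 G (3 · G) m ⟨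
      (3 · G ⋆ 3 · G) m
        ≡⟨ ⋆-cong (3 · G) H′ (3 · G) H′ 3G≡H′ 3G≡H′ m ⟩
      (H′ ⋆ H′) m
        ≡⟨ ⋆-distribʳ-⊕ H (2 · δ) H′ m ⟩
      (H ⋆ H′) m + (2 · δ ⋆ H′) m
        ≡⟨ cong₂ _+_ (⋆-distribˡ-⊕ H H (2 · δ) m) (·-⋆ 2 δ H′ m) ⟩
      (H ⋆ H) m + (H ⋆ 2 · δ) m + 2 * (δ ⋆ H′) m
        ≡⟨ cong₂ (λ u v → (H ⋆ H) m + u + 2 * v) (⋆-· 2 H δ m) (δ-⋆ H′ (2 + n)) ⟩
      (H ⋆ H) m + 2 * (H ⋆ δ) m + 2 * H′ (2 + n)
        ≡⟨ cong (λ u → (H ⋆ H) m + 2 * u + 2 * H′ (2 + n)) (⋆-δ H (2 + n)) ⟩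
      (H ⋆ H) m + 2 * (3 * G (2 + n)) + 2 * (3 * G (2 + n) + 0)
        ≡⟨ collect ((H ⋆ H) m) (G (2 + n)) ⟩
      (H ⋆ H) m + 12 * G (2 + n)
        ∎
      where
      open ≡-Reasoning
      m = 3 + n
      H′ : Seq
      H′ = H ⊕ 2 · δ
      3G≡H′ : ∀ i → 3 * G i ≡ H′ i
      3G≡H′ i = sym (H+2δ≡3G i)
      collect : ∀ h g → h + 2 * (3 * g) + 2 * (3 * g + 0) ≡ h + 12 * g
      collect = solve-∀

    16Y+12G≤9G : ∀ n → (∀ {i} → i < 3 + n → Bounds i) → 16 * Y (3 + n) + 12 * G (2 + n) ≤ 9 * G (3 + n)
    16Y+12G≤9G n below = begin
      16 * Y (3 + n) + 12 * G (2 + n)     ≤⟨ +-monoˡ-≤ (12 * G (2 + n)) (16Y≤H⋆H (suc n) below) ⟩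
      (H ⋆ H) (3 + n) + 12 * G (2 + n)    ≡⟨ 9G≡H⋆H+12G n ⟨
      9 * G (3 + n)                       ∎
      where open ≤-Reasoning

    open CatalanRecurrence 2 G G-rec using (ratio-bound)

    2Y≤G-step : ∀ n → (∀ {i} → i < n → Bounds i) → 2 * Y n ≤ G n
    2Y≤G-step 0 _ = ≤-reflexive (trans (cong (2 *_) Y₀) (sym G₀))
    2Y≤G-step 1 _ = ≤-reflexive (trans (cong (2 *_) Y₁) (sym G₁))
    2Y≤G-step 2 _ rewrite Y-rec 2 | G-rec 2 | ⋆-2 A A A₀ A₀ | ⋆-2 G G G₀ G₀ | A₁ | G₁ = s≤s (s≤s z≤n)
    2Y≤G-step (suc (suc (suc n))) below =
      16y+12g′≤9g⇒2y≤g (Y (3 + n)) (G (3 + n)) (G (2 + n)) (16Y+12G≤9G n below) (ratio-bound (suc n))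

  bounds : ∀ n → Bounds n
  bounds = <-rec Bounds λ n below → F≤Y-step n below , 2Y≤G-step n below


-- Counting rows of truth tables over all bracketings

private
  variable
    A B : Set

sum-map-+ : ∀ (h h′ : A → ℕ) xs → sum (map (λ x → h x + h′ x) xs) ≡ sum (map h xs) + sum (map h′ xs)
sum-map-+ h h′ []       = refl
sum-map-+ h h′ (x ∷ xs) rewrite sum-map-+ h h′ xs = +-interchange (h x) (h′ x) _ _

sum-map-*ˡ : ∀ c (h : A → ℕ) xs → sum (map (λ x → c * h x) xs) ≡ c * sum (map h xs)
sum-map-*ˡ c h []       = sym (*-zeroʳ c)
sum-map-*ˡ c h (x ∷ xs) rewrite sum-map-*ˡ c h xs = sym (*-distribˡ-+ c (h x) _)

sum-map-concatMap : ∀ (h : A → ℕ) (φ : B → List A) xs →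
                    sum (map h (concatMap φ xs)) ≡ sum (map (λ x → sum (map h (φ x))) xs)
sum-map-concatMap h φ []       = refl
sum-map-concatMap h φ (x ∷ xs) = begin
  sum (map h (φ x ++ concatMap φ xs))               ≡⟨ cong sum (map-++ h (φ x) (concatMap φ xs)) ⟩
  sum (map h (φ x) ++ map h (concatMap φ xs))       ≡⟨ sum-++ (map h (φ x)) (map h (concatMap φ xs)) ⟩
  sum (map h (φ x)) + sum (map h (concatMap φ xs))  ≡⟨ cong (_+_ (sum (map h (φ x)))) (sum-map-concatMap h φ xs) ⟩
  sum (map (λ x → sum (map h (φ x))) (x ∷ xs))      ∎
  where open ≡-Reasoning

sum-map-product : ∀ (p : A → ℕ) (q : B → ℕ) xs ys →
                  sum (map (λ x → sum (map (λ y → p x * q y) ys)) xs) ≡ sum (map p xs) * sum (map q ys)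
sum-map-product p q []       ys = refl
sum-map-product p q (x ∷ xs) ys = trans (cong₂ _+_ (sum-map-*ˡ (p x) q ys) (sum-map-product p q xs ys))
                                        (sym (*-distribʳ-+ (sum (map q ys)) (p x) _))

sum-map-applyUpTo : ∀ (h f : ℕ → ℕ) m → sum (map h (applyUpTo f m)) ≡ ∑< m (h ∘ f)
sum-map-applyUpTo h f zero    = refl
sum-map-applyUpTo h f (suc m) = cong (_+_ (h (f 0))) (sum-map-applyUpTo h (f ∘ suc) m)

size : Tree → ℕ
size leaf       = 1
size (node l r) = size l + size r

private
  split-size : ∀ {n i} → i < suc n → suc i + (suc n ∸ i) ≡ 2 + n
  split-size i<1+n = cong suc (m+[n∸m]≡n (<⇒≤ i<1+n))

bracketings′-size : ∀ fuel n → All (λ t → size t ≡ n) (bracketings′ fuel n)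
bracketings′-size _          zero          = []
bracketings′-size _          (suc zero)    = refl ∷ []
bracketings′-size zero       (suc (suc n)) = []
bracketings′-size (suc fuel) (suc (suc n)) =
  All.concat⁺ (All.map⁺ (All.applyUpTo⁺₁ (λ i → i) (suc n) λ {i} i<1+n →
    All.concat⁺ (All.map⁺ (All.map (λ |l| →
      All.map⁺ (All.map (λ |r| → trans (cong₂ _+_ |l| |r|) (split-size i<1+n))
                        (bracketings′-size fuel (suc n ∸ i))))
      (bracketings′-size fuel (suc i))))))

bracketings′-fuel : ∀ {fuel fuel′} n → n ≤ suc fuel → n ≤ suc fuel′ →
                    bracketings′ fuel n ≡ bracketings′ fuel′ n
bracketings′-fuel zero          _ _ = refl
bracketings′-fuel (suc zero)    _ _ = refl
bracketings′-fuel {zero}     {_}        (suc (suc n)) (s≤s ()) _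
bracketings′-fuel {suc _}    {zero}     (suc (suc n)) _ (s≤s ())
bracketings′-fuel {suc fuel} {suc fuel′} (suc (suc n)) (s≤s n<fuel) (s≤s n<fuel′) =
  cong concat (map-cong-local (All.applyUpTo⁺₁ (λ i → i) (suc n) λ {i} i<1+n →
    cong₂ (λ Rs Ls → concatMap (λ l → map (node l) Rs) Ls)
      (bracketings′-fuel (suc n ∸ i) (≤-trans (m∸n≤m (suc n) i) n<fuel) (≤-trans (m∸n≤m (suc n) i) n<fuel′))
      (bracketings′-fuel (suc i) (≤-trans i<1+n n<fuel) (≤-trans i<1+n n<fuel′))))

bracketings′≡bracketings : ∀ {fuel n} → n ≤ suc fuel → bracketings′ fuel n ≡ bracketings n
bracketings′≡bracketings {n = n} n≤1+fuel = bracketings′-fuel n n≤1+fuel (n≤1+n n)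

∑bracketings : (ℕ → Tree → ℕ) → Seq
∑bracketings Q n = sum (map (Q n) (bracketings n))

NodeProduct : (P Q R : ℕ → Tree → ℕ) → Set
NodeProduct P Q R = ∀ {i j} l r → size l ≡ i → size r ≡ j → Q (i + j) (node l r) ≡ P i l * R j r

∑bracketings-⋆ : ∀ P Q R → NodeProduct P Q R →
                 ∀ n → ∑bracketings Q (2 + n) ≡ (∑bracketings P ⋆ ∑bracketings R) (2 + n)
∑bracketings-⋆ P Q R Q≡P*R n = begin
  sum (map (Q m) (concatMap φ (upTo (suc n))))
    ≡⟨ sum-map-concatMap (Q m) φ (upTo (suc n)) ⟩
  sum (map (λ i → sum (map (Q m) (φ i))) (upTo (suc n)))
    ≡⟨ sum-map-applyUpTo (λ i → sum (map (Q m) (φ i))) (λ i → i) (suc n) ⟩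
  ∑< (suc n) (λ i → sum (map (Q m) (φ i)))
    ≡⟨ ∑<-cong (suc n) split-at ⟩
  ∑< (suc n) (λ i → ∑bracketings P (suc i) * ∑bracketings R (suc n ∸ i))
    ≡⟨ ⋆-interior (∑bracketings P) (∑bracketings R) n refl refl ⟨
  (∑bracketings P ⋆ ∑bracketings R) m
    ∎
  where
  open ≡-Reasoning
  m = 2 + n
  φ : ℕ → List Tree
  φ i = concatMap (λ l → map (node l) (bracketings′ (suc n) (suc n ∸ i))) (bracketings′ (suc n) (suc i))
  split-at : ∀ {i} → i < suc n → sum (map (Q m) (φ i)) ≡ ∑bracketings P (suc i) * ∑bracketings R (suc n ∸ i)
  split-at {i} i<1+n = begin
    sum (map (Q m) (φ i))
      ≡⟨ cong₂ (λ Rs Ls → sum (map (Q m) (concatMap (λ l → map (node l) Rs) Ls)))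
               (bracketings′≡bracketings (≤-trans (m∸n≤m (suc n) i) (n≤1+n (suc n))))
               (bracketings′≡bracketings (≤-trans i<1+n (n≤1+n (suc n)))) ⟩
    sum (map (Q m) (concatMap (λ l → map (node l) Rs) Ls))
      ≡⟨ sum-map-concatMap (Q m) (λ l → map (node l) Rs) Ls ⟩
    sum (map (λ l → sum (map (Q m) (map (node l) Rs))) Ls)
      ≡⟨ cong sum (map-cong-local (All.map (λ |l| → cong sum (trans (sym (map-∘ Rs))
           (map-cong-local (All.map (node-term |l|) (bracketings′-size (suc n ∸ i) (suc n ∸ i))))))
           (bracketings′-size (suc i) (suc i)))) ⟩
    sum (map (λ l → sum (map (λ r → P (suc i) l * R (suc n ∸ i) r) Rs)) Ls)
      ≡⟨ sum-map-product (P (suc i)) (R (suc n ∸ i)) Ls Rs ⟩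
    ∑bracketings P (suc i) * ∑bracketings R (suc n ∸ i)
      ∎
    where
    Ls = bracketings (suc i)
    Rs = bracketings (suc n ∸ i)
    node-term : ∀ {l r} → size l ≡ suc i → size r ≡ suc n ∸ i → Q m (node l r) ≡ P (suc i) l * R (suc n ∸ i) r
    node-term {l} {r} |l| |r| =
      trans (cong (λ k → Q k (node l r)) (sym (split-size i<1+n))) (Q≡P*R l r |l| |r|)

splitAt-length : ∀ m (xs : List A) → m ≤ length xs → ∃₂ λ ys zs → xs ≡ ys ++ zs × length ys ≡ m
splitAt-length zero    xs       _         = [] , xs , refl , refl
splitAt-length (suc m) (x ∷ xs) (s≤s m≤n) with splitAt-length m xs m≤n
... | ys , zs , refl , refl = x ∷ ys , zs , refl , refl

module _ (⊛ : Bool → Bool → Bool) where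

  eval′-node : ∀ l r bs → eval′ ⊛ (node l r) bs ≡
    (⊛ (proj₁ (eval′ ⊛ l bs)) (proj₁ (eval′ ⊛ r (proj₂ (eval′ ⊛ l bs)))) ,
     proj₂ (eval′ ⊛ r (proj₂ (eval′ ⊛ l bs))))
  eval′-node l r bs with eval′ ⊛ l bs
  ... | a , bs′ with eval′ ⊛ r bs′
  ... | c , bs″ = refl

  eval′-++      : ∀ t ν ρ → length ν ≡ size t → eval′ ⊛ t (ν ++ ρ) ≡ (eval ⊛ t ν , ρ)
  eval′-node-++ : ∀ l r ν₁ ν₂ ρ → length ν₁ ≡ size l → length ν₂ ≡ size r →
                  eval′ ⊛ (node l r) (ν₁ ++ ν₂ ++ ρ) ≡ (⊛ (eval ⊛ l ν₁) (eval ⊛ r ν₂) , ρ)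
  eval-node-++  : ∀ l r ν₁ ν₂ → length ν₁ ≡ size l → length ν₂ ≡ size r →
                  eval ⊛ (node l r) (ν₁ ++ ν₂) ≡ ⊛ (eval ⊛ l ν₁) (eval ⊛ r ν₂)

  eval′-++ leaf       (b ∷ []) ρ _   = refl
  eval′-++ (node l r) ν        ρ |ν| with splitAt-length (size l) ν (subst (size l ≤_) (sym |ν|) (m≤m+n _ _))
  ... | ν₁ , ν₂ , refl , |ν₁| = begin
    eval′ ⊛ (node l r) ((ν₁ ++ ν₂) ++ ρ)   ≡⟨ cong (eval′ ⊛ (node l r)) (++-assoc ν₁ ν₂ ρ) ⟩
    eval′ ⊛ (node l r) (ν₁ ++ ν₂ ++ ρ)     ≡⟨ eval′-node-++ l r ν₁ ν₂ ρ |ν₁| |ν₂| ⟩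
    (⊛ (eval ⊛ l ν₁) (eval ⊛ r ν₂) , ρ)     ≡⟨ cong (_, ρ) (eval-node-++ l r ν₁ ν₂ |ν₁| |ν₂|) ⟨
    (eval ⊛ (node l r) (ν₁ ++ ν₂) , ρ)      ∎
    where
    open ≡-Reasoning
    |ν₂| : length ν₂ ≡ size r
    |ν₂| = +-cancelˡ-≡ (size l) (length ν₂) (size r)
             (trans (cong (_+ length ν₂) (sym |ν₁|)) (trans (sym (length-++ ν₁)) |ν|))

  eval′-node-++ l r ν₁ ν₂ ρ |ν₁| |ν₂|
    rewrite eval′-node l r (ν₁ ++ ν₂ ++ ρ) | eval′-++ l ν₁ (ν₂ ++ ρ) |ν₁| | eval′-++ r ν₂ ρ |ν₂| = refl

  eval-node-++ l r ν₁ ν₂ |ν₁| |ν₂| =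
    trans (cong (λ ν₂′ → eval ⊛ (node l r) (ν₁ ++ ν₂′)) (sym (++-identityʳ ν₂)))
          (cong proj₁ (eval′-node-++ l r ν₁ ν₂ [] |ν₁| |ν₂|))

∑valuations : ℕ → (List Bool → ℕ) → ℕ
∑valuations n h = sum (map h (valuations n))

valuations-length : ∀ n → All (λ ν → length ν ≡ n) (valuations n)
valuations-length zero    = refl ∷ []
valuations-length (suc n) =
  All.concat⁺ (All.map⁺ (All.map (λ |ν| → cong suc |ν| ∷ cong suc |ν| ∷ []) (valuations-length n)))

∑valuations-suc : ∀ n h → ∑valuations (suc n) h ≡ ∑valuations n (λ ν → h (false ∷ ν) + h (true ∷ ν))
∑valuations-suc n h = trans (sum-map-concatMap h (λ ν → (false ∷ ν) ∷ (true ∷ ν) ∷ []) (valuations n))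
  (cong sum (map-cong (λ ν → cong (_+_ (h (false ∷ ν))) (+-identityʳ (h (true ∷ ν)))) (valuations n)))

∑valuations-+ : ∀ m n h →
                ∑valuations (m + n) h ≡ ∑valuations m (λ ν₁ → ∑valuations n (λ ν₂ → h (ν₁ ++ ν₂)))
∑valuations-+ zero    n h = sym (+-identityʳ _)
∑valuations-+ (suc m) n h = begin
  ∑valuations (suc m + n) h
    ≡⟨ ∑valuations-suc (m + n) h ⟩
  ∑valuations (m + n) (λ ν → h (false ∷ ν) + h (true ∷ ν))
    ≡⟨ ∑valuations-+ m n _ ⟩
  ∑valuations m (λ ν₁ → ∑valuations n (λ ν₂ → h (false ∷ ν₁ ++ ν₂) + h (true ∷ ν₁ ++ ν₂)))
    ≡⟨ cong sum (map-cong (λ ν₁ → sum-map-+ (h₀ ν₁) (h₁ ν₁) (valuations n)) (valuations m)) ⟩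
  ∑valuations m (λ ν₁ → ∑valuations n (h₀ ν₁) + ∑valuations n (h₁ ν₁))
    ≡⟨ ∑valuations-suc m (λ ν₁ → ∑valuations n (λ ν₂ → h (ν₁ ++ ν₂))) ⟨
  ∑valuations (suc m) (λ ν₁ → ∑valuations n (λ ν₂ → h (ν₁ ++ ν₂)))
    ∎
  where
  open ≡-Reasoning
  h₀ h₁ : List Bool → List Bool → ℕ
  h₀ ν₁ ν₂ = h (false ∷ ν₁ ++ ν₂)
  h₁ ν₁ ν₂ = h (true ∷ ν₁ ++ ν₂)

∑valuations-1 : ∀ n → ∑valuations n (λ _ → 1) ≡ 2 ^ n
∑valuations-1 zero    = refl
∑valuations-1 (suc n) = trans (∑valuations-suc n (λ _ → 1))
  (trans (sum-map-*ˡ 2 (λ _ → 1) (valuations n)) (cong (2 *_) (∑valuations-1 n)))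

indicator : Bool → Bool → ℕ
indicator true  x = if x then 1 else 0
indicator false x = if x then 0 else 1

rows : Bool → (Bool → Bool → Bool) → ℕ → Tree → ℕ
rows b ⊛ n t = ∑valuations n (λ ν → indicator b (eval ⊛ t ν))

rows-node : ∀ b b₁ b₂ ⊛ → (∀ x y → indicator b (⊛ x y) ≡ indicator b₁ x * indicator b₂ y) →
            NodeProduct (rows b₁ ⊛) (rows b ⊛) (rows b₂ ⊛)
rows-node b b₁ b₂ ⊛ split {i} {j} l r |l| |r| = begin
  ∑valuations (i + j) (λ ν → indicator b (eval ⊛ (node l r) ν))
    ≡⟨ ∑valuations-+ i j _ ⟩
  ∑valuations i (λ ν₁ → ∑valuations j (λ ν₂ → indicator b (eval ⊛ (node l r) (ν₁ ++ ν₂))))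
    ≡⟨ cong sum (map-cong-local (All.map (λ |ν₁| → cong sum (map-cong-local (All.map (row |ν₁|)
         (valuations-length j)))) (valuations-length i))) ⟩
  ∑valuations i (λ ν₁ → ∑valuations j (λ ν₂ → p ν₁ * q ν₂))
    ≡⟨ sum-map-product p q (valuations i) (valuations j) ⟩
  rows b₁ ⊛ i l * rows b₂ ⊛ j r
    ∎
  where
  open ≡-Reasoning
  p q : List Bool → ℕ
  p ν₁ = indicator b₁ (eval ⊛ l ν₁)
  q ν₂ = indicator b₂ (eval ⊛ r ν₂)
  row : ∀ {ν₁ ν₂} → length ν₁ ≡ i → length ν₂ ≡ j → indicator b (eval ⊛ (node l r) (ν₁ ++ ν₂)) ≡ p ν₁ * q ν₂
  row {ν₁} {ν₂} |ν₁| |ν₂| =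
    trans (cong (indicator b) (eval-node-++ ⊛ l r ν₁ ν₂ (trans |ν₁| (sym |l|)) (trans |ν₂| (sym |r|))))
          (split (eval ⊛ l ν₁) (eval ⊛ r ν₂))

rows-true+false : ∀ ⊛ n t → rows true ⊛ n t + rows false ⊛ n t ≡ 2 ^ n
rows-true+false ⊛ n t = begin
  rows true ⊛ n t + rows false ⊛ n t
    ≡⟨ sum-map-+ (λ ν → indicator true (eval ⊛ t ν)) (λ ν → indicator false (eval ⊛ t ν)) (valuations n) ⟨
  ∑valuations n (λ ν → indicator true (eval ⊛ t ν) + indicator false (eval ⊛ t ν))
    ≡⟨ cong sum (map-cong (λ ν → one (eval ⊛ t ν)) (valuations n)) ⟩
  ∑valuations n (λ _ → 1)
    ≡⟨ ∑valuations-1 n ⟩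
  2 ^ n
    ∎
  where
  open ≡-Reasoning
  one : ∀ x → indicator true x + indicator false x ≡ 1
  one true  = refl
  one false = refl

allRows : Seq
allRows = ∑bracketings (λ n _ → 2 ^ n)

∑bracketings-true+false : ∀ ⊛ n → ∑bracketings (rows true ⊛) n + ∑bracketings (rows false ⊛) n ≡ allRows n
∑bracketings-true+false ⊛ n =
  trans (sym (sum-map-+ (rows true ⊛ n) (rows false ⊛ n) (bracketings n)))
        (cong sum (map-cong (rows-true+false ⊛ n) (bracketings n)))

indicator-false-⇒ : ∀ x y → indicator false (x ⇒ y) ≡ indicator true x * indicator false y
indicator-false-⇒ true  true  = refl
indicator-false-⇒ true  false = refl
indicator-false-⇒ false true  = refl
indicator-false-⇒ false false = refl

indicator-false-⇀ : ∀ x y → indicator false (x ⇀ y) ≡ indicator true x * indicator true y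
indicator-false-⇀ true  true  = refl
indicator-false-⇀ true  false = refl
indicator-false-⇀ false true  = refl
indicator-false-⇀ false false = refl

allRows-rec : ∀ n → allRows n ≡ (2 · δ ⊕ allRows ⋆ allRows) n
allRows-rec 0             = refl
allRows-rec 1             = refl
allRows-rec (suc (suc n)) = ∑bracketings-⋆ Q Q Q (λ {i} {j} _ _ _ _ → ^-distribˡ-+-* 2 i j) n
  where
  Q : ℕ → Tree → ℕ
  Q n _ = 2 ^ n

-- y and f unfold to ∑bracketings (rows false _⇀_) and ∑bracketings (rows false _⇒_).
y-rec : ∀ n → y n ≡ (δ ⊕ ∑bracketings (rows true _⇀_) ⋆ ∑bracketings (rows true _⇀_)) n
y-rec 0             = refl
y-rec 1             = refl
y-rec (suc (suc n)) = ∑bracketings-⋆ (rows true _⇀_) (rows false _⇀_) (rows true _⇀_)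
                        (rows-node false true true _⇀_ indicator-false-⇀) n

f-rec : ∀ n → f n ≡ (δ ⊕ ∑bracketings (rows true _⇒_) ⋆ f) n
f-rec 0             = refl
f-rec 1             = refl
f-rec (suc (suc n)) = ∑bracketings-⋆ (rows true _⇒_) (rows false _⇒_) (rows false _⇒_)
                        (rows-node false true false _⇒_ indicator-false-⇒) n

f≤y : ∀ n → f n ≤ y n
f≤y n = proj₁ (bounds n)
  where
  open ZeroRowComparison allRows (∑bracketings (rows true _⇀_)) y (∑bracketings (rows true _⇒_)) f
         refl allRows-rec y-rec f-rec (∑bracketings-true+false _⇀_) (∑bracketings-true+false _⇒_)

-- i / suc d is by definition fromℚᵘ (mkℚᵘ i d), so the comparison happens between unnormalised fractions.
/-monoˡ-≤ : ∀ {i j} d .{{_ : NonZero d}} → i ℤ.≤ j → (i / d) ℚ.≤ (j / d)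
/-monoˡ-≤ {i} {j} (suc d) i≤j = ℚ.toℚᵘ-cancel-≤
  (ℚᵘ.≤-respˡ-≃ (ℚᵘ.≃-sym (ℚ.toℚᵘ-fromℚᵘ (ℚᵘ.mkℚᵘ i d)))
  (ℚᵘ.≤-respʳ-≃ (ℚᵘ.≃-sym (ℚ.toℚᵘ-fromℚᵘ (ℚᵘ.mkℚᵘ j d)))
    (ℚᵘ.*≤* (ℤ.*-monoʳ-≤-nonNeg (+ suc d) i≤j))))

corollary3p5 : (n : ℕ) → (1≤n : 1 ≤ n) →
    ((+ f n) / g n) {{g-nonZero 1≤n}} ℚ.≤ ((+ y n) / g n) {{g-nonZero 1≤n}}
corollary3p5 n 1≤n = /-monoˡ-≤ (g n) {{g-nonZero 1≤n}} (ℤ.+≤+ (f≤y n))
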